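{- Let $\mathcal{C}$ be a nowhere dense class of static graphs with denseness function $d$, let $\Delta^t\in\mathbb{N}$, and let $\mathcal{C}'$ be the class of all temporal graphs with footprint in $\mathcal{C}$ and maximum temporal degree at most $\Delta^t$. For $\mathcal{G}\in\mathcal{C}'$ let $H:=\mathrm{Gf}(\mathcal{S}_{\Delta^t}(\mathcal{G}))$ be the Gaifman graph of the degree encoding of $\mathcal{G}$. Then the maximum degree of $H$ satisfies $\Delta(H)\le 2\Delta^t$, and consequently the class of all such graphs $H$ is nowhere dense.
   Context: A temporal graph $\mathcal{G}=(V,E,\lambda)$ consists of a static graph $(V,E)$ (the footprint) and a labelling $\lambda$ assigning each edge a nonempty finite set of time steps in $\mathbb{N}_{\ge1}$; temporal edges are pairs $(e,t)$ with $t\in\lambda(e)$, forming the set $\mathcal{E}$. The temporal degree of $v$ is the number of temporal edges $(e,t)$ with $v\in e$; the maximum temporal degree is its maximum over $v\in V$. The degree encoding $\mathcal{S}_{\Delta^t}(\mathcal{G})$ is the relational structure with universe $V\cup\mathcal{E}$, unary predicates for $V$ and $\mathcal{E}$, and binary relations $\mathsf{inc}((uv,t),x)$ iff $x\in\{u,v\}$, and $\mathsf{psuc}((e_1,t_1),(e_2,t_2))$ iff $t_1<t_2$ and $e_1,e_2$ share an endpoint. The Gaifman graph $\mathrm{Gf}(\mathcal{S})$ of a relational structure $\mathcal{S}$ with universe $U$ is the simple undirected graph on $U$ in which distinct $a,b$ are adjacent iff they occur together in some tuple of some relation of arity at least 2. For graphs $H,G$ and $r\in\mathbb{N}$, $H\preceq_r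 G$ if some graph obtained from $H$ by replacing a subset of its edges by pairwise internally vertex-disjoint paths of length at most $r+1$ is isomorphic to a subgraph of $G$. A graph class is nowhere dense if there is $d:\mathbb{N}\to\mathbb{N}$ (a denseness function) with $K_{d(r)}\not\preceq_r G$ for all $r$ and all $G$ in the class. -}

module Defs where

open import Level using (0ℓ)
open import Data.Nat using (ℕ; zero; suc; _≤_; _<_)
open import Data.Fin using (Fin)
import Data.Fin as F
open import Data.List using (List; []; _∷_; length; map; allFin)
open import Data.Nat.ListAction using (sum)
open import Data.List.Relation.Unary.All using (All)
open import Data.List.Relation.Unary.Unique.Propositional using (Unique)
open import Data.List.Membership.Propositional using (_∈_; _∉_)
open import Data.Vec using (Vec; []; _∷_)
import Data.Vec.Membership.Propositional as VM
open import Data.Product using (Σ; Σ-syntax; ∃; ∃-syntax; _×_; _,_)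
open import Data.Sum using (_⊎_; inj₁; inj₂)
open import Data.Empty using (⊥)
open import Relation.Nullary using (¬_)
open import Relation.Binary.PropositionalEquality using (_≡_; _≢_)

record Graph : Set₁ where
  field
    V          : Set
    Adj        : V → V → Set
    Adj-sym    : ∀ {u v} → Adj u v → Adj v u
    Adj-irrefl : ∀ {v} → ¬ Adj v v

open Graph public

GraphClass : Set₂
GraphClass = Graph → Set₁

MaxDegree≤ : Graph → ℕ → Set
MaxDegree≤ G k = ∀ (v : V G) (ns : List (V G)) → Unique ns →
                 All (Adj G v) ns → length ns ≤ k

K : ℕ → Graph
K m = record
  { V = Fin m
  ; Adj = λ x y → x ≢ y
  ; Adj-sym = λ p q → p (Relation.Binary.PropositionalEquality.sym q)
  ; Adj-irrefl = λ p → p Relation.Binary.PropositionalEquality.refl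
  }

Chain : (G : Graph) → V G → List (V G) → V G → Set
Chain G a []       b = Adj G a b
Chain G a (x ∷ xs) b = Adj G a x × Chain G x xs b

Disjoint : {A : Set} → List A → List A → Set
Disjoint xs ys = ∀ {z} → z ∈ xs → z ∉ ys

-- H ≼_r G : a subdivision of H, in which every edge is replaced by a
-- path of length at most r+1 (length 1 = edge not subdivided), with the
-- paths pairwise internally vertex-disjoint, is isomorphic to a subgraph
-- of G.
record _≼[_]_ (H : Graph) (r : ℕ) (G : Graph) : Set where
  field
    φ          : V H → V G
    φ-inj      : ∀ {x y} → φ x ≡ φ y → x ≡ y
    interior   : (x y : V H) → Adj H x y → List (V G)
    path       : ∀ x y (p : Adj H x y) → Chain G (φ x) (interior x y p) (φ y)
    short      : ∀ x y (p : Adj H x y) → length (interior x y p) ≤ r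
    simple     : ∀ x y (p : Adj H x y) → Unique (interior x y p)
    avoids-φ   : ∀ x y (p : Adj H x y) z → φ z ∉ interior x y p
    disjoint   : ∀ x y (p : Adj H x y) x' y' (p' : Adj H x' y') →
                 ¬ (x ≡ x' × y ≡ y') → ¬ (x ≡ y' × y ≡ x') →
                 Disjoint (interior x y p) (interior x' y' p')

DensenessFunction : GraphClass → (ℕ → ℕ) → Set₁
DensenessFunction 𝒞 d = ∀ (r : ℕ) (G : Graph) → 𝒞 G → ¬ (K (d r) ≼[ r ] G)

NowhereDense : GraphClass → Set₁
NowhereDense 𝒞 = Σ[ d ∈ (ℕ → ℕ) ] DensenessFunction 𝒞 d

-- Temporal graphs with vertex set Fin n.  The labelling λ(uv) is a
-- duplicate-free list of time steps ≥ 1, stored symmetrically; it is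
-- nonempty exactly on the edges of the footprint.

record TemporalGraph : Set₁ where
  field
    n          : ℕ
    FAdj       : Fin n → Fin n → Set
    FAdj-sym   : ∀ {u v} → FAdj u v → FAdj v u
    FAdj-irrefl : ∀ {v} → ¬ FAdj v v
    lab        : Fin n → Fin n → List ℕ
    lab-sym    : ∀ u v → lab u v ≡ lab v u
    lab-unique : ∀ u v → Unique (lab u v)
    lab-pos    : ∀ u v → All (λ t → 1 ≤ t) (lab u v)
    lab-edge   : ∀ u v → FAdj u v → lab u v ≢ []
    lab-nonedge : ∀ u v → ¬ FAdj u v → lab u v ≡ []

module _ (𝒢 : TemporalGraph) where
  open TemporalGraph 𝒢

  footprint : Graph
  footprint = record { V = Fin n ; Adj = FAdj ; Adj-sym = FAdj-sym ; Adj-irrefl = FAdj-irrefl }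

  -- temporal edges (uv, t), the edge uv written with u < v
  record TEdge : Set where
    constructor tedge
    field
      u    : Fin n
      v    : Fin n
      u<v  : u F.< v
      t    : ℕ
      t∈   : t ∈ lab u v

  temporalDegree : Fin n → ℕ
  temporalDegree v = sum (map (λ w → length (lab v w)) (allFin n))

MaxTemporalDegree≤ : TemporalGraph → ℕ → Set
MaxTemporalDegree≤ 𝒢 k = ∀ v → temporalDegree 𝒢 v ≤ k

record Structure : Set₁ where
  field
    U     : Set
    nrel  : ℕ
    arity : Fin nrel → ℕ
    rel   : (i : Fin nrel) → Vec U (arity i) → Set

Gaifman : Structure → Graph
Gaifman S = record
  { V = U
  ; Adj = GAdj
  ; Adj-sym = λ { (a≢b , i , ar , xs , r , a∈ , b∈) →
                  (λ e → a≢b (Relation.Binary.PropositionalEquality.sym e)) , i , ar , xs , r , b∈ , a∈ }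
  ; Adj-irrefl = λ { (a≢a , _) → a≢a Relation.Binary.PropositionalEquality.refl }
  }
  where
  open Structure S
  GAdj : U → U → Set
  GAdj a b = a ≢ b × Σ[ i ∈ Fin nrel ] (2 ≤ arity i) ×
             Σ[ xs ∈ Vec U (arity i) ] rel i xs × a VM.∈ xs × b VM.∈ xs

-- The degree encoding S_{Δ^t}(𝒢): universe V ∪ 𝓔, unary predicates
-- for V and 𝓔, binary relations inc and psuc.

module _ (𝒢 : TemporalGraph) where
  open TemporalGraph 𝒢

  Universe : Set
  Universe = Fin n ⊎ TEdge 𝒢

  IsVertex : Universe → Set
  IsVertex (inj₁ _) = Data.Unit.⊤ where import Data.Unit
  IsVertex (inj₂ _) = ⊥

  IsTEdge : Universe → Set
  IsTEdge (inj₁ _) = ⊥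
  IsTEdge (inj₂ _) = Data.Unit.⊤ where import Data.Unit

  Inc : Universe → Universe → Set
  Inc (inj₂ (tedge u v _ _ _)) (inj₁ x) = x ≡ u ⊎ x ≡ v
  Inc _ _ = ⊥

  ShareEndpoint : TEdge 𝒢 → TEdge 𝒢 → Set
  ShareEndpoint (tedge u₁ v₁ _ _ _) (tedge u₂ v₂ _ _ _) =
    u₁ ≡ u₂ ⊎ u₁ ≡ v₂ ⊎ v₁ ≡ u₂ ⊎ v₁ ≡ v₂

  Psuc : Universe → Universe → Set
  Psuc (inj₂ ε₁) (inj₂ ε₂) = TEdge.t ε₁ < TEdge.t ε₂ × ShareEndpoint ε₁ ε₂
  Psuc _ _ = ⊥

  encArity : Fin 4 → ℕ
  encArity F.zero = 1
  encArity (F.suc F.zero) = 1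
  encArity (F.suc (F.suc F.zero)) = 2
  encArity (F.suc (F.suc (F.suc F.zero))) = 2

  encRel : (i : Fin 4) → Vec Universe (encArity i) → Set
  encRel F.zero (x ∷ []) = IsVertex x
  encRel (F.suc F.zero) (x ∷ []) = IsTEdge x
  encRel (F.suc (F.suc F.zero)) (a ∷ b ∷ []) = Inc a b
  encRel (F.suc (F.suc (F.suc F.zero))) (a ∷ b ∷ []) = Psuc a b

  degreeEncoding : Structure
  degreeEncoding = record { U = Universe ; nrel = 4 ; arity = encArity ; rel = encRel }

TemporalClass : GraphClass → ℕ → TemporalGraph → Set₁
TemporalClass 𝒞 Δt 𝒢 = 𝒞 (footprint 𝒢) × MaxTemporalDegree≤ 𝒢 Δt

EncodingClass : GraphClass → ℕ → GraphClass
EncodingClass 𝒞 Δt H =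
  Σ[ 𝒢 ∈ TemporalGraph ] TemporalClass 𝒞 Δt 𝒢 × H ≡ Gaifman (degreeEncoding 𝒢)

{-# OPTIONS --safe #-}
module Submission where

-- In the Gaifman graph of the degree encoding a vertex x is adjacent only to the
-- temporal edges at x, and a temporal edge (uv,t) only to u, v and the other
-- temporal edges at u or v; so every element has at most 2Δt neighbours.  A graph
-- of maximum degree D has no K_{D+2} as an r-shallow topological minor, since the
-- first steps of the paths from one branch vertex to the D+1 others are distinct
-- neighbours of it.

open import Defs
open import Data.Nat using (ℕ; _*_; suc; _+_; _≤_; z≤n; s≤s)
open import Data.Product using (_×_; _,_)

open import Data.Nat.ListAction using (sum)
open import Data.Nat.Properties as ℕ using (m≤m+n; +-mono-≤; +-suc; +-identityʳ; 1+n≰n; module ≤-Reasoning)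
open import Data.Fin using (Fin; zero; suc)
import Data.Fin.Properties as Fin
open import Data.List using (List; []; _∷_; length; map; concatMap; allFin; filter; tabulate; _++_)
open import Data.List.Properties using (length-map; length-++; length-tabulate; filter-notAll)
open import Data.List.Relation.Unary.All as All using (All; []; _∷_)
import Data.List.Relation.Unary.All.Properties as All
open import Data.List.Relation.Unary.Any as Any using (here; there)
open import Data.List.Relation.Unary.Any.Properties using (mapWith∈⁺)
open import Data.List.Relation.Unary.AllPairs using ([]; _∷_)
import Data.List.Relation.Unary.AllPairs.Properties as AllPairs
open import Data.List.Relation.Unary.Unique.Propositional using (Unique)
open import Data.List.Membership.Propositional using (_∈_; _∉_; mapWith∈)
open import Data.List.Membership.Propositional.Properties using (∈-map⁺; ∈-++⁺ˡ; ∈-++⁺ʳ; ∈-concat⁺′; ∈-allFin; ∈-filter⁺)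
open import Data.List.Membership.Setoid.Properties using (unique⇒irrelevant; length-mapWith∈)
open import Data.Vec using ([]; _∷_)
import Data.Vec.Membership.Propositional as Vec
open import Data.Vec.Relation.Unary.Any using (here; there)
open import Data.Sum as Sum using (_⊎_; inj₁; inj₂; assocˡ)
open import Data.Sum.Properties using (≡-dec)
open import Data.Empty using (⊥-elim)
open import Function using (_∘_)
open import Relation.Nullary using (¬_; ¬?)
open import Relation.Nullary.Decidable using (map′; _×-dec_)
open import Relation.Binary using (DecidableEquality; tri<; tri≈; tri>)
open import Relation.Binary.PropositionalEquality using (_≡_; _≢_; refl; sym; trans; cong; cong₂; subst; setoid)

module DecEqList {A : Set} (_≟_ : DecidableEquality A) where

  _∖_ : List A → A → List A
  xs ∖ x = filter (λ y → ¬? (x ≟ y)) xs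

  ∈-∖⁺ : ∀ {x y xs} → y ∈ xs → x ≢ y → y ∈ xs ∖ x
  ∈-∖⁺ = ∈-filter⁺ (λ y → ¬? (_ ≟ y))

  length-∖-< : ∀ {x xs} → x ∈ xs → suc (length (xs ∖ x)) ≤ length xs
  length-∖-< {x} {xs} x∈xs = filter-notAll (λ y → ¬? (x ≟ y)) xs (Any.map (λ x≡y x≢y → x≢y x≡y) x∈xs)

  unique-⊆⇒length≤ : ∀ {xs ys} → Unique xs → All (_∈ ys) xs → length xs ≤ length ys
  unique-⊆⇒length≤ [] [] = z≤n
  unique-⊆⇒length≤ {x ∷ xs} {ys} (x∉xs ∷ xs-unique) (x∈ys ∷ xs⊆ys) = begin
    suc (length xs)          ≤⟨ s≤s (unique-⊆⇒length≤ xs-unique xs⊆ys∖x) ⟩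
    suc (length (ys ∖ x))    ≤⟨ length-∖-< x∈ys ⟩
    length ys                ∎
    where
    open ≤-Reasoning
    xs⊆ys∖x : All (_∈ ys ∖ x) xs
    xs⊆ys∖x = All.zipWith (λ (y∈ys , x≢y) → ∈-∖⁺ y∈ys x≢y) (xs⊆ys , x∉xs)

length-concatMap-≤ : ∀ {A B : Set} {f : A → List B} {g : A → ℕ} →
                     (∀ a → length (f a) ≤ g a) → ∀ as → length (concatMap f as) ≤ sum (map g as)
length-concatMap-≤ f≤g [] = z≤n
length-concatMap-≤ {f = f} {g} f≤g (a ∷ as) = begin
  length (f a ++ concatMap f as)          ≡⟨ length-++ (f a) ⟩
  length (f a) + length (concatMap f as)  ≤⟨ +-mono-≤ (f≤g a) (length-concatMap-≤ f≤g as) ⟩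
  g a + sum (map g as)                    ∎
  where open ≤-Reasoning

pair-related : ∀ {A : Set} {R : A → A → Set} {a b x y} → a ≢ b →
               a Vec.∈ x ∷ y ∷ [] → b Vec.∈ x ∷ y ∷ [] → R x y → R a b ⊎ R b a
pair-related a≢b (here refl)         (here refl)         _ = ⊥-elim (a≢b refl)
pair-related _   (here refl)         (there (here refl)) r = inj₁ r
pair-related _   (there (here refl)) (here refl)         r = inj₂ r
pair-related a≢b (there (here refl)) (there (here refl)) _ = ⊥-elim (a≢b refl)

firstOf : {A : Set} → List A → A → A
firstOf []      b = b
firstOf (x ∷ _) _ = x

Chain-firstOf : ∀ (G : Graph) {a b} xs → Chain G a xs b → Adj G a (firstOf xs b)
Chain-firstOf G []      a~b       = a~b
Chain-firstOf G (_ ∷ _) (a~x , _) = a~x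

firstOf-≢ : ∀ {A : Set} {b c : A} xs ys → b ≢ c → b ∉ ys → c ∉ xs → Disjoint xs ys →
            firstOf xs b ≢ firstOf ys c
firstOf-≢ []      []      b≢c _   _   _        = b≢c
firstOf-≢ []      (_ ∷ _) _   b∉ys _   _        = b∉ys ∘ here
firstOf-≢ (_ ∷ _) []      _   _   c∉xs _        = c∉xs ∘ here ∘ sym
firstOf-≢ (_ ∷ _) (_ ∷ _) _   _   _    disjoint = disjoint (here refl) ∘ here

module _ {F H : Graph} {r : ℕ} (M : F ≼[ r ] H) where
  open _≼[_]_ M

  firstStep : ∀ {x y} → Adj F x y → V H
  firstStep {x} {y} x~y = firstOf (interior x y x~y) (φ y)

  firstStep-adjacent : ∀ {x y} (x~y : Adj F x y) → Adj H (φ x) (firstStep x~y)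
  firstStep-adjacent {x} {y} x~y = Chain-firstOf H (interior x y x~y) (path x y x~y)

  firstStep-≢ : ∀ {x y y'} (x~y : Adj F x y) (x~y' : Adj F x y') → y ≢ y' → firstStep x~y ≢ firstStep x~y'
  firstStep-≢ {x} {y} {y'} x~y x~y' y≢y' =
    firstOf-≢ (interior x y x~y) (interior x y' x~y') (y≢y' ∘ φ-inj)
              (avoids-φ x y' x~y' y) (avoids-φ x y x~y y')
              (disjoint x y x~y x y' x~y' (λ (_ , y≡y') → y≢y' y≡y')
                        (λ (x≡y' , _) → Adj-irrefl F (subst (Adj F x) (sym x≡y') x~y')))

K-⋠-maxDegree≤ : ∀ {H D r} → MaxDegree≤ H D → ¬ (K (2 + D) ≼[ r ] H)
K-⋠-maxDegree≤ {H} {D} Δ≤D M = 1+n≰n (begin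
  suc D                   ≡⟨ length-tabulate step ⟨
  length (tabulate step)  ≤⟨ Δ≤D (φ zero) (tabulate step) steps-distinct steps-adjacent ⟩
  D                       ∎)
  where
  open ≤-Reasoning
  open _≼[_]_ M using (φ)
  zero~suc : ∀ j → Adj (K (2 + D)) zero (suc j)
  zero~suc _ ()
  step : Fin (suc D) → V H
  step j = firstStep M (zero~suc j)
  steps-distinct : Unique (tabulate step)
  steps-distinct = AllPairs.tabulate⁺ (λ {j} {k} j≢k → firstStep-≢ M (zero~suc j) (zero~suc k) (j≢k ∘ Fin.suc-injective))
  steps-adjacent : All (Adj H (φ zero)) (tabulate step)
  steps-adjacent = All.tabulate⁺ (λ j → firstStep-adjacent M (zero~suc j))

module DegreeEncoding (𝒢 : TemporalGraph) where
  open TemporalGraph 𝒢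
  open TEdge

  G : Graph
  G = Gaifman (degreeEncoding 𝒢)

  TEdge-≡ : ∀ {e e' : TEdge 𝒢} → u e ≡ u e' → v e ≡ v e' → t e ≡ t e' → e ≡ e'
  TEdge-≡ {tedge x y x<y s s∈} {tedge _ _ x<y' _ s∈'} refl refl refl =
    cong₂ (λ p q → tedge x y p s q) (Fin.<-irrelevant x<y x<y')
          (unique⇒irrelevant (setoid ℕ) ℕ.≡-irrelevant (lab-unique x y) s∈ s∈')

  _≟ₑ_ : DecidableEquality (TEdge 𝒢)
  e ≟ₑ e' = map′ (λ (p , q , r) → TEdge-≡ p q r) (λ { refl → refl , refl , refl })
                 (u e Fin.≟ u e' ×-dec v e Fin.≟ v e' ×-dec t e ℕ.≟ t e')

  _≟ᵤ_ : DecidableEquality (Universe 𝒢)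
  _≟ᵤ_ = ≡-dec Fin._≟_ _≟ₑ_

  open DecEqList _≟ₑ_ using (_∖_; ∈-∖⁺; length-∖-<)

  Endpoint : Fin n → TEdge 𝒢 → Set
  Endpoint x e = x ≡ u e ⊎ x ≡ v e

  edgesBetween : Fin n → Fin n → List (TEdge 𝒢)
  edgesBetween x y with Fin.<-cmp x y
  ... | tri< x<y _ _ = mapWith∈ (lab x y) (tedge x y x<y _)
  ... | tri≈ _ _ _   = []
  ... | tri> _ _ y<x = mapWith∈ (lab y x) (tedge y x y<x _)

  length-edgesBetween : ∀ x y → length (edgesBetween x y) ≤ length (lab x y)
  length-edgesBetween x y with Fin.<-cmp x y
  ... | tri< _ _ _ = ℕ.≤-reflexive (length-mapWith∈ (setoid ℕ) (lab x y))
  ... | tri≈ _ _ _ = z≤n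
  ... | tri> _ _ _ = ℕ.≤-reflexive (trans (length-mapWith∈ (setoid ℕ) (lab y x)) (cong length (lab-sym y x)))

  ∈-edgesBetween-uv : ∀ e → e ∈ edgesBetween (u e) (v e)
  ∈-edgesBetween-uv (tedge x y x<y s s∈) with Fin.<-cmp x y
  ... | tri< _ _ _   = mapWith∈⁺ _ (s , s∈ , TEdge-≡ refl refl refl)
  ... | tri≈ x≮y _ _ = ⊥-elim (x≮y x<y)
  ... | tri> x≮y _ _ = ⊥-elim (x≮y x<y)

  ∈-edgesBetween-vu : ∀ e → e ∈ edgesBetween (v e) (u e)
  ∈-edgesBetween-vu (tedge x y x<y s s∈) with Fin.<-cmp y x
  ... | tri> _ _ _   = mapWith∈⁺ _ (s , s∈ , TEdge-≡ refl refl refl)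
  ... | tri≈ _ y≡x _ = ⊥-elim (Fin.<-irrefl (sym y≡x) x<y)
  ... | tri< y<x _ _ = ⊥-elim (Fin.<-asym x<y y<x)

  incidentEdges : Fin n → List (TEdge 𝒢)
  incidentEdges x = concatMap (edgesBetween x) (allFin n)

  length-incidentEdges : ∀ x → length (incidentEdges x) ≤ temporalDegree 𝒢 x
  length-incidentEdges x = length-concatMap-≤ (length-edgesBetween x) (allFin n)

  endpoint⇒∈incidentEdges : ∀ {x} e → Endpoint x e → e ∈ incidentEdges x
  endpoint⇒∈incidentEdges e (inj₁ refl) =
    ∈-concat⁺′ (∈-edgesBetween-uv e) (∈-map⁺ (edgesBetween (u e)) (∈-allFin (v e)))
  endpoint⇒∈incidentEdges e (inj₂ refl) =
    ∈-concat⁺′ (∈-edgesBetween-vu e) (∈-map⁺ (edgesBetween (v e)) (∈-allFin (u e)))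

  ShareEndpoint-sym : ∀ {e e'} → ShareEndpoint 𝒢 e e' → ShareEndpoint 𝒢 e' e
  ShareEndpoint-sym (inj₁ eq)                 = inj₁ (sym eq)
  ShareEndpoint-sym (inj₂ (inj₁ eq))          = inj₂ (inj₂ (inj₁ (sym eq)))
  ShareEndpoint-sym (inj₂ (inj₂ (inj₁ eq)))   = inj₂ (inj₁ (sym eq))
  ShareEndpoint-sym (inj₂ (inj₂ (inj₂ eq)))   = inj₂ (inj₂ (inj₂ (sym eq)))

  Related : Universe 𝒢 → Universe 𝒢 → Set
  Related a b = Inc 𝒢 a b ⊎ Psuc 𝒢 a b

  adj⇒related : ∀ {a b} → Adj G a b → Related a b ⊎ Related b a
  adj⇒related (_ , zero , s≤s () , _)
  adj⇒related (_ , suc zero , s≤s () , _)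
  adj⇒related (a≢b , suc (suc zero) , _ , (_ ∷ _ ∷ []) , r , a∈ , b∈) =
    Sum.map inj₁ inj₁ (pair-related {R = Inc 𝒢} a≢b a∈ b∈ r)
  adj⇒related (a≢b , suc (suc (suc zero)) , _ , (_ ∷ _ ∷ []) , r , a∈ , b∈) =
    Sum.map inj₂ inj₂ (pair-related {R = Psuc 𝒢} a≢b a∈ b∈ r)

  neighbourhood : Universe 𝒢 → List (Universe 𝒢)
  neighbourhood (inj₁ x) = map inj₂ (incidentEdges x)
  neighbourhood (inj₂ e) =
    inj₁ (u e) ∷ inj₁ (v e) ∷ map inj₂ (incidentEdges (u e) ∖ e ++ incidentEdges (v e) ∖ e)

  sharing⇒∈neighbourhood : ∀ {e e'} → e ≢ e' → ShareEndpoint 𝒢 e e' → inj₂ e' ∈ neighbourhood (inj₂ e)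
  sharing⇒∈neighbourhood {e} {e'} e≢e' shared = there (there (∈-map⁺ inj₂ (in-either (assocˡ shared))))
    where
    in-either : Endpoint (u e) e' ⊎ Endpoint (v e) e' → e' ∈ incidentEdges (u e) ∖ e ++ incidentEdges (v e) ∖ e
    in-either (inj₁ ue∈e') = ∈-++⁺ˡ (∈-∖⁺ (endpoint⇒∈incidentEdges e' ue∈e') e≢e')
    in-either (inj₂ ve∈e') = ∈-++⁺ʳ _ (∈-∖⁺ (endpoint⇒∈incidentEdges e' ve∈e') e≢e')

  related⇒∈neighbourhood : ∀ {a b} → a ≢ b → Related a b ⊎ Related b a → b ∈ neighbourhood a
  related⇒∈neighbourhood {inj₁ x} {inj₂ e} _ (inj₂ (inj₁ x∈e)) = ∈-map⁺ inj₂ (endpoint⇒∈incidentEdges e x∈e)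
  related⇒∈neighbourhood {inj₂ e} {inj₁ _} _ (inj₁ (inj₁ (inj₁ refl))) = here refl
  related⇒∈neighbourhood {inj₂ e} {inj₁ _} _ (inj₁ (inj₁ (inj₂ refl))) = there (here refl)
  related⇒∈neighbourhood {inj₂ e} {inj₂ e'} a≢b (inj₁ (inj₂ (_ , shared))) =
    sharing⇒∈neighbourhood (a≢b ∘ cong inj₂) shared
  related⇒∈neighbourhood {inj₂ e} {inj₂ e'} a≢b (inj₂ (inj₂ (_ , shared))) =
    sharing⇒∈neighbourhood (a≢b ∘ cong inj₂) (ShareEndpoint-sym {e'} {e} shared)
  related⇒∈neighbourhood {inj₁ _}           _ (inj₁ (inj₁ ()))
  related⇒∈neighbourhood {inj₁ _}           _ (inj₁ (inj₂ ()))
  related⇒∈neighbourhood {inj₁ _} {inj₁ _}  _ (inj₂ (inj₁ ()))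
  related⇒∈neighbourhood {inj₁ _} {inj₂ _}  _ (inj₂ (inj₂ ()))
  related⇒∈neighbourhood {inj₂ _} {inj₁ _}  _ (inj₁ (inj₂ ()))
  related⇒∈neighbourhood {inj₂ _} {inj₂ _}  _ (inj₁ (inj₁ ()))
  related⇒∈neighbourhood {_}      {inj₁ _}  _ (inj₂ (inj₂ ()))
  related⇒∈neighbourhood {inj₂ _} {inj₂ _}  _ (inj₂ (inj₁ ()))

  adj⇒∈neighbourhood : ∀ {a b} → Adj G a b → b ∈ neighbourhood a
  adj⇒∈neighbourhood adj@(a≢b , _) = related⇒∈neighbourhood a≢b (adj⇒related adj)

  length-neighbourhood : ∀ {Δt} → MaxTemporalDegree≤ 𝒢 Δt → ∀ a → length (neighbourhood a) ≤ 2 * Δt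
  length-neighbourhood {Δt} deg≤Δt (inj₁ x) = begin
    length (map inj₂ (incidentEdges x))  ≡⟨ length-map inj₂ (incidentEdges x) ⟩
    length (incidentEdges x)             ≤⟨ length-incidentEdges x ⟩
    temporalDegree 𝒢 x                   ≤⟨ deg≤Δt x ⟩
    Δt                                   ≤⟨ m≤m+n Δt _ ⟩
    2 * Δt                               ∎
    where open ≤-Reasoning
  length-neighbourhood {Δt} deg≤Δt (inj₂ e) = begin
    2 + length (map inj₂ (Eᵤ ∖ e ++ Eᵥ ∖ e))  ≡⟨ cong (2 +_) (length-map inj₂ (Eᵤ ∖ e ++ Eᵥ ∖ e)) ⟩
    2 + length (Eᵤ ∖ e ++ Eᵥ ∖ e)             ≡⟨ cong (2 +_) (length-++ (Eᵤ ∖ e)) ⟩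
    2 + (length (Eᵤ ∖ e) + length (Eᵥ ∖ e))   ≡⟨ cong suc (sym (+-suc _ _)) ⟩
    suc (length (Eᵤ ∖ e)) + suc (length (Eᵥ ∖ e))
      ≤⟨ +-mono-≤ (length-∖-< (endpoint⇒∈incidentEdges e (inj₁ refl)))
                  (length-∖-< (endpoint⇒∈incidentEdges e (inj₂ refl))) ⟩
    length Eᵤ + length Eᵥ                     ≤⟨ +-mono-≤ (length-incidentEdges (u e)) (length-incidentEdges (v e)) ⟩
    temporalDegree 𝒢 (u e) + temporalDegree 𝒢 (v e)  ≤⟨ +-mono-≤ (deg≤Δt (u e)) (deg≤Δt (v e)) ⟩
    Δt + Δt                                   ≡⟨ cong (Δt +_) (sym (+-identityʳ Δt)) ⟩
    2 * Δt                                    ∎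
    where
    open ≤-Reasoning
    Eᵤ Eᵥ : List (TEdge 𝒢)
    Eᵤ = incidentEdges (u e)
    Eᵥ = incidentEdges (v e)

  maxDegree≤ : ∀ {Δt} → MaxTemporalDegree≤ 𝒢 Δt → MaxDegree≤ G (2 * Δt)
  maxDegree≤ deg≤Δt a bs bs-unique bs-adjacent =
    ℕ.≤-trans (unique-⊆⇒length≤ bs-unique (All.map adj⇒∈neighbourhood bs-adjacent))
              (length-neighbourhood deg≤Δt a)
    where open DecEqList _≟ᵤ_ using (unique-⊆⇒length≤)

mainTheorem6 : (𝒞 : GraphClass) (d : ℕ → ℕ) → DensenessFunction 𝒞 d →
               (Δt : ℕ) →
               (∀ (𝒢 : TemporalGraph) → TemporalClass 𝒞 Δt 𝒢 →
                  MaxDegree≤ (Gaifman (degreeEncoding 𝒢)) (2 * Δt))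
               × NowhereDense (EncodingClass 𝒞 Δt)
mainTheorem6 𝒞 _ _ Δt = encoding-maxDegree≤ , (λ _ → 2 + 2 * Δt) , excludes-cliques
  where
  encoding-maxDegree≤ : ∀ 𝒢 → TemporalClass 𝒞 Δt 𝒢 → MaxDegree≤ (Gaifman (degreeEncoding 𝒢)) (2 * Δt)
  encoding-maxDegree≤ 𝒢 (_ , deg≤Δt) = DegreeEncoding.maxDegree≤ 𝒢 deg≤Δt

  excludes-cliques : DensenessFunction (EncodingClass 𝒞 Δt) (λ _ → 2 + 2 * Δt)
  excludes-cliques _ _ (𝒢 , 𝒢∈𝒞' , refl) = K-⋠-maxDegree≤ (encoding-maxDegree≤ 𝒢 𝒢∈𝒞')
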